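{- For any graph $G$, the Cartesian product $G\,\Box\,C_4$ has an EOD-set that is parallel with respect to $G$ if and only if $G$ is a $C_4$-parallel amenable graph.
   Context: All graphs are finite and simple; $C_4$ has vertex set $[4]=\{1,\dots,4\}$ with $i$ adjacent to $i\pm1$ modulo 4. An EOD-set of a graph $X$ is a set $D\subseteq V(X)$ with $\bigcup_{v\in D}N(v)=V(X)$ and $N(u)\cap N(v)=\emptyset$ for all distinct $u,v\in D$ ($N$ = open neighborhood). An EOD-set $D$ of $G\,\Box\,H$ is parallel with respect to $G$ if for every edge of the subgraph induced by $D$, its end vertices have distinct $G$-coordinates. For $S\subseteq V(G)$, "$\langle S\rangle$ is a matching" means every vertex of $S$ has exactly one neighbor in $S$ (empty $S$ allowed). A weak partition of a set is a collection of pairwise disjoint, possibly empty, subsets whose union is the set. $G$ is $C_4$-parallel amenable if there is a weak partition $\{V_0,V_1,\dots,V_4\}$ of $V(G)$ such that, with subscripts taken modulo 4 in $[4]$: (A) if $x\in V_0$ then $|N(x)\cap V_i|=1$ for every $i\in[4]$; (B) $\langle V_i\rangle$ is a matching for every $i\in[4]$; (C$'$) $\langle V_i\cup V_{i+1}\rangle$ is a matching for every $i\in[4]$; (D$'$) if $x\in V_i$ ($i\in[4]$), then $|N(x)\cap V_{i+2}|=1$. -}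

module Defs where

open import Data.Nat using (ℕ)
open import Data.Fin using (Fin; zero; suc)
open import Data.Product using (Σ; ∃; _×_; _,_; proj₁; proj₂)
open import Data.Sum using (_⊎_; inj₁; inj₂)
open import Data.Empty using (⊥)
open import Relation.Nullary using (¬_)
open import Relation.Binary.PropositionalEquality using (_≡_; _≢_; refl; sym)

record Graph (V : Set) : Set₁ where
  field
    Adj    : V → V → Set
    adj-sym    : ∀ {u v} → Adj u v → Adj v u
    adj-irrefl : ∀ {u} → ¬ Adj u u
open Graph public

FinGraph : ℕ → Set₁
FinGraph n = Graph (Fin n)

-- cyclic successor on Fin 4 (vertices 1..4 of C4 are zero..3; i ↦ i+1 mod 4)
next4 : Fin 4 → Fin 4
next4 zero = suc zero
next4 (suc zero) = suc (suc zero)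
next4 (suc (suc zero)) = suc (suc (suc zero))
next4 (suc (suc (suc zero))) = zero

private
  next4-fix : ∀ i → next4 i ≢ i
  next4-fix zero ()
  next4-fix (suc zero) ()
  next4-fix (suc (suc zero)) ()
  next4-fix (suc (suc (suc zero))) ()

C4Adj : Fin 4 → Fin 4 → Set
C4Adj i j = (j ≡ next4 i) ⊎ (i ≡ next4 j)

C4 : Graph (Fin 4)
C4 = record
  { Adj = C4Adj
  ; adj-sym = λ { (inj₁ e) → inj₂ e ; (inj₂ e) → inj₁ e }
  ; adj-irrefl = λ { {u} (inj₁ e) → next4-fix u (sym e) ; {u} (inj₂ e) → next4-fix u (sym e) }
  }

□Adj : ∀ {V W} → Graph V → Graph W → V × W → V × W → Set
□Adj G H (g , h) (g' , h') = (g ≡ g' × Adj H h h') ⊎ (Adj G g g' × h ≡ h')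

_□_ : ∀ {V W} → Graph V → Graph W → Graph (V × W)
G □ H = record
  { Adj = □Adj G H
  ; adj-sym = λ { (inj₁ (refl , a)) → inj₁ (refl , Graph.adj-sym H a)
            ; (inj₂ (a , refl)) → inj₂ (Graph.adj-sym G a , refl) }
  ; adj-irrefl = λ { (inj₁ (_ , a)) → Graph.adj-irrefl H a
               ; (inj₂ (a , _)) → Graph.adj-irrefl G a }
  }

ExactlyOne : ∀ {V : Set} → (V → Set) → Set
ExactlyOne {V} P = Σ V λ y → P y × (∀ z → P z → z ≡ y)

-- EOD-set (efficient open domination): open neighbourhoods of D cover V
-- and are pairwise disjoint.  N(v) = { w | Adj v w }.
IsEOD : ∀ {V} → Graph V → (V → Set) → Set
IsEOD {V} X D =
  (∀ w → Σ V λ v → D v × Adj X v w) ×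
  (∀ u v → D u → D v → u ≢ v → ∀ w → ¬ (Adj X u w × Adj X v w))

IsParallel : ∀ {V W} → Graph V → Graph W → (V × W → Set) → Set
IsParallel G H D =
  ∀ u v → D u → D v → Adj (G □ H) u v → proj₁ u ≢ proj₁ v

-- ⟨S⟩ is a matching: every vertex of S has exactly one neighbour in S
IsMatching : ∀ {V} → Graph V → (V → Set) → Set
IsMatching X S = ∀ x → S x → ExactlyOne (λ y → S y × Adj X x y)

-- A weak partition {V0,...,V4} is given by a labelling
-- f : V → Fin 5, with V0 = f⁻¹(zero) and V_i = f⁻¹(suc (i-1)) for i ∈ [4];
-- index i ∈ [4] is represented by i-1 ∈ Fin 4, and i+1 (mod 4) by next4.
C4ParallelAmenable : ∀ {V} → Graph V → Set
C4ParallelAmenable {V} G =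
  Σ (V → Fin 5) λ f →
    -- (A)
    (∀ x → f x ≡ zero → ∀ (i : Fin 4) → ExactlyOne (λ y → Adj G x y × f y ≡ suc i)) ×
    -- (B)
    (∀ (i : Fin 4) → IsMatching G (λ y → f y ≡ suc i)) ×
    -- (C')
    (∀ (i : Fin 4) → IsMatching G (λ y → (f y ≡ suc i) ⊎ (f y ≡ suc (next4 i)))) ×
    -- (D')
    (∀ x (i : Fin 4) → f x ≡ suc i →
       ExactlyOne (λ y → Adj G x y × f y ≡ suc (next4 (next4 i))))

module Submission where

-- A labelling f : V → Fin 5 (label zero = "in V₀", label suc h = "in V_h")
-- determines the set LabelSet f = { (g , h) | f g ≡ suc h } of G □ C4.
-- A vertex (x , h) can be dominated by LabelSet f either inside its own
-- C4-fibre (by (x , h') with h' adjacent to h) or across it (by (y , h)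
-- with y adjacent to x).  Call (x , h) lonely if the first is impossible.
-- The heart of the proof is that each of the two properties
--   "LabelSet f is an EOD-set"   and   "f satisfies (A), (B), (C'), (D')"
-- is equivalent to the local DominationProfile of f: every lonely (x , h)
-- has exactly one G-neighbour y of x labelled h, and no vertex is dominated
-- both inside and across its fibre.  Since LabelSet f is always parallel,
-- this gives the backward direction.  For the forward direction, a parallel
-- EOD-set D meets each C4-fibre at most once, so (using decidable equality
-- of vertices to find the occupied position) D is LabelSet f for a
-- labelling f read off from D.

open import Defs
open import Data.Nat using (ℕ)
open import Data.Fin using (Fin; zero; suc) renaming (_≟_ to _≟ᶠ_)
open import Data.Fin.Properties using (suc-injective; 0≢1+n; any?)
open import Data.Product using (Σ; _×_; _,_; proj₁; proj₂)
open import Data.Product.Properties using (≡-dec)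
open import Data.Sum using (_⊎_; inj₁; inj₂)
open import Data.Empty using (⊥; ⊥-elim)
open import Relation.Nullary using (¬_; yes; no)
open import Relation.Nullary.Decidable using (decidable-stable)
open import Relation.Binary.Definitions using (DecidableEquality)
open import Relation.Binary.PropositionalEquality
  using (_≡_; _≢_; refl; sym; trans; cong; subst)
open import Function.Bundles using (_⇔_; mk⇔)

antipode : Fin 4 → Fin 4
antipode i = next4 (next4 i)

c4-position : ∀ i h → (h ≡ i) ⊎ (C4Adj i h ⊎ (h ≡ antipode i))
c4-position zero zero = inj₁ refl
c4-position zero (suc zero) = inj₂ (inj₁ (inj₁ refl))
c4-position zero (suc (suc zero)) = inj₂ (inj₂ refl)
c4-position zero (suc (suc (suc zero))) = inj₂ (inj₁ (inj₂ refl))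
c4-position (suc zero) zero = inj₂ (inj₁ (inj₂ refl))
c4-position (suc zero) (suc zero) = inj₁ refl
c4-position (suc zero) (suc (suc zero)) = inj₂ (inj₁ (inj₁ refl))
c4-position (suc zero) (suc (suc (suc zero))) = inj₂ (inj₂ refl)
c4-position (suc (suc zero)) zero = inj₂ (inj₂ refl)
c4-position (suc (suc zero)) (suc zero) = inj₂ (inj₁ (inj₂ refl))
c4-position (suc (suc zero)) (suc (suc zero)) = inj₁ refl
c4-position (suc (suc zero)) (suc (suc (suc zero))) = inj₂ (inj₁ (inj₁ refl))
c4-position (suc (suc (suc zero))) zero = inj₂ (inj₁ (inj₁ refl))
c4-position (suc (suc (suc zero))) (suc zero) = inj₂ (inj₂ refl)
c4-position (suc (suc (suc zero))) (suc (suc zero)) = inj₂ (inj₁ (inj₂ refl))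
c4-position (suc (suc (suc zero))) (suc (suc (suc zero))) = inj₁ refl

next4-not-self : ∀ i → next4 i ≢ i
next4-not-self i e = Graph.adj-irrefl C4 (inj₁ (sym e))

antipode-not-self : ∀ i → antipode i ≢ i
antipode-not-self zero ()
antipode-not-self (suc zero) ()
antipode-not-self (suc (suc zero)) ()
antipode-not-self (suc (suc (suc zero))) ()

antipode-not-adjacent : ∀ i → ¬ C4Adj i (antipode i)
antipode-not-adjacent zero (inj₁ ())
antipode-not-adjacent zero (inj₂ ())
antipode-not-adjacent (suc zero) (inj₁ ())
antipode-not-adjacent (suc zero) (inj₂ ())
antipode-not-adjacent (suc (suc zero)) (inj₁ ())
antipode-not-adjacent (suc (suc zero)) (inj₂ ())
antipode-not-adjacent (suc (suc (suc zero))) (inj₁ ())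
antipode-not-adjacent (suc (suc (suc zero))) (inj₂ ())

adjacent-distinct : ∀ {V} (X : Graph V) {x y} → Adj X x y → x ≢ y
adjacent-distinct X xy refl = Graph.adj-irrefl X xy

exactlyOne-swap : ∀ {V} {P Q : V → Set} →
  ExactlyOne (λ y → P y × Q y) → ExactlyOne (λ y → Q y × P y)
exactlyOne-swap (y , (p , q) , only) = y , (q , p) , λ z (q' , p') → only z (p' , q')

same-dominator : ∀ {V} → DecidableEquality V → {X : Graph V} {D : V → Set} →
  IsEOD X D → ∀ {u v w} → D u → D v → Adj X u w → Adj X v w → u ≡ v
same-dominator _≟_ (_ , disjoint) {u} {v} {w} Du Dv uw vw =
  decidable-stable (u ≟ v) (λ u≢v → disjoint u v Du Dv u≢v w (uw , vw))

IsEOD-cong : ∀ {V} {X : Graph V} {D D′ : V → Set} →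
  (∀ {v} → D v → D′ v) → (∀ {v} → D′ v → D v) → IsEOD X D → IsEOD X D′
IsEOD-cong to from (cover , disjoint) =
  (λ w → let (v , Dv , vw) = cover w in v , to Dv , vw) ,
  (λ u v D′u D′v → disjoint u v (from D′u) (from D′v))

module Labelling {V : Set} (G : Graph V) (f : V → Fin 5) where

  LabelSet : V × Fin 4 → Set
  LabelSet (g , h) = f g ≡ suc h

  Lonely : V → Fin 4 → Set
  Lonely x h = ∀ {h′} → f x ≡ suc h′ → ¬ C4Adj h′ h

  LonelyUniquelyDominated : Set
  LonelyUniquelyDominated =
    ∀ x h → Lonely x h → ExactlyOne (λ y → Adj G x y × f y ≡ suc h)

  NoMixedDomination : Set
  NoMixedDomination =
    ∀ {x y h h′} → f x ≡ suc h′ → C4Adj h′ h → Adj G x y → f y ≡ suc h → ⊥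

  DominationProfile : Set
  DominationProfile = LonelyUniquelyDominated × NoMixedDomination

  AmenableLabelling : Set
  AmenableLabelling =
    (∀ x → f x ≡ zero → ∀ (i : Fin 4) → ExactlyOne (λ y → Adj G x y × f y ≡ suc i)) ×
    (∀ (i : Fin 4) → IsMatching G (λ y → f y ≡ suc i)) ×
    (∀ (i : Fin 4) → IsMatching G (λ y → (f y ≡ suc i) ⊎ (f y ≡ suc (next4 i)))) ×
    (∀ x (i : Fin 4) → f x ≡ suc i →
       ExactlyOne (λ y → Adj G x y × f y ≡ suc (next4 (next4 i))))

  unlabelled-lonely : ∀ {x h} → f x ≡ zero → Lonely x h
  unlabelled-lonely fx fx′ = ⊥-elim (0≢1+n (trans (sym fx) fx′))

  labelled-lonely : ∀ {x i h} → f x ≡ suc i → ¬ C4Adj i h → Lonely x h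
  labelled-lonely {h = h} fx ¬adj fx′ =
    subst (λ k → ¬ C4Adj k h) (suc-injective (trans (sym fx) fx′)) ¬adj

  fibre-dominated? : ∀ x h → (Σ (Fin 4) λ h′ → f x ≡ suc h′ × C4Adj h′ h) ⊎ Lonely x h
  fibre-dominated? x h = by-label (f x) refl
    where
    by-label : ∀ l → f x ≡ l → (Σ (Fin 4) λ h′ → f x ≡ suc h′ × C4Adj h′ h) ⊎ Lonely x h
    by-label zero fx = inj₂ (unlabelled-lonely fx)
    by-label (suc i) fx with c4-position i h
    ... | inj₁ refl = inj₂ (labelled-lonely fx (Graph.adj-irrefl C4))
    ... | inj₂ (inj₁ adj) = inj₁ (i , fx , adj)
    ... | inj₂ (inj₂ refl) = inj₂ (labelled-lonely fx (antipode-not-adjacent i))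

  -- A fibre meets LabelSet at most once, so LabelSet is always parallel.
  LabelSet-parallel : IsParallel G C4 LabelSet
  LabelSet-parallel (g , h) (.g , h′) fg fg′ (inj₁ (refl , hh′)) refl =
    Graph.adj-irrefl C4 (subst (C4Adj h) (sym (suc-injective (trans (sym fg) fg′))) hh′)
  LabelSet-parallel _ _ _ _ (inj₂ (gg′ , _)) refl = Graph.adj-irrefl G gg′

  -- Dominators inside a fibre are unique because a vertex has one label;
  -- across a fibre, by LonelyUniquelyDominated; mixed ones do not exist.
  profile→EOD : DominationProfile → IsEOD (G □ C4) LabelSet
  profile→EOD (unique , no-mixed) =
    cover , λ u v Du Dv u≢v w (uw , vw) → u≢v (same Du Dv uw vw)
    where
    cover : ∀ w → Σ (V × Fin 4) λ v → LabelSet v × Adj (G □ C4) v w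
    cover (x , h) with fibre-dominated? x h
    ... | inj₁ (h′ , fx , adj) = (x , h′) , fx , inj₁ (refl , adj)
    ... | inj₂ lonely with unique x h lonely
    ...   | y , (xy , fy) , _ = (y , h) , fy , inj₂ (Graph.adj-sym G xy , refl)

    same : ∀ {u v w} → LabelSet u → LabelSet v →
           Adj (G □ C4) u w → Adj (G □ C4) v w → u ≡ v
    same {x , _} fx fx′ (inj₁ (refl , _)) (inj₁ (refl , _)) =
      cong (x ,_) (suc-injective (trans (sym fx) fx′))
    same fx fy (inj₁ (refl , adj)) (inj₂ (yx , refl)) =
      ⊥-elim (no-mixed fx adj (Graph.adj-sym G yx) fy)
    same fy fx (inj₂ (yx , refl)) (inj₁ (refl , adj)) =
      ⊥-elim (no-mixed fx adj (Graph.adj-sym G yx) fy)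
    same {y₁ , h} {y₂ , .h} {x , .h} fy₁ fy₂ (inj₂ (y₁x , refl)) (inj₂ (y₂x , refl))
      with fibre-dominated? x h
    ... | inj₁ (_ , fx , adj) = ⊥-elim (no-mixed fx adj (Graph.adj-sym G y₁x) fy₁)
    ... | inj₂ lonely with unique x h lonely
    ...   | _ , _ , only = cong (_, h)
            (trans (only y₁ (Graph.adj-sym G y₁x , fy₁)) (sym (only y₂ (Graph.adj-sym G y₂x , fy₂))))

  -- The cross-fibre dominator of a lonely vertex is its EOD-dominator, and a
  -- mixed domination would give a vertex two distinct dominators.
  EOD→profile : DecidableEquality V → IsEOD (G □ C4) LabelSet → DominationProfile
  EOD→profile _≟_ eod = unique , no-mixed
    where
    same : ∀ {u v w} → LabelSet u → LabelSet v →
           Adj (G □ C4) u w → Adj (G □ C4) v w → u ≡ v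
    same = same-dominator (≡-dec _≟_ _≟ᶠ_) {X = G □ C4} eod

    unique : LonelyUniquelyDominated
    unique x h lonely with proj₁ eod (x , h)
    ... | _ , fx , inj₁ (refl , adj) = ⊥-elim (lonely fx adj)
    ... | (y , .h) , fy , inj₂ (yx , refl) =
      y , (Graph.adj-sym G yx , fy) ,
      λ z (xz , fz) → cong proj₁ (same fz fy (inj₂ (Graph.adj-sym G xz , refl)) (inj₂ (yx , refl)))

    no-mixed : NoMixedDomination
    no-mixed fx adj xy fy =
      adjacent-distinct G xy (cong proj₁ (same fx fy (inj₁ (refl , adj)) (inj₂ (Graph.adj-sym G xy , refl))))

  -- Lonely vertices are covered by (A), (B) or (D') according to their
  -- position relative to their own label; (B) and (C') exclude mixed domination.
  amenable→profile : AmenableLabelling → DominationProfile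
  amenable→profile (condA , condB , condC , condD) = unique , no-mixed
    where
    -- By (B) x has one neighbour labelled i, and by (C') no other neighbour
    -- labelled i or i+1; so no neighbour is labelled i+1.
    no-successor : ∀ {x y i} → f x ≡ suc i → Adj G x y → f y ≡ suc (next4 i) → ⊥
    no-successor {x} {y} {i} fx xy fy with condB i x fx | condC i x (inj₁ fx)
    ... | y₀ , (fy₀ , xy₀) , _ | _ , _ , only =
      next4-not-self i (suc-injective (trans (sym fy) (trans (cong f y≡y₀) fy₀)))
      where
      y≡y₀ : y ≡ y₀
      y≡y₀ = trans (only y (inj₂ fy , xy)) (sym (only y₀ (inj₁ fy₀ , xy₀)))

    no-mixed : NoMixedDomination
    no-mixed fx (inj₁ refl) xy fy = no-successor fx xy fy
    no-mixed fx (inj₂ refl) xy fy = no-successor fy (Graph.adj-sym G xy) fx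

    unique : LonelyUniquelyDominated
    unique x h lonely = by-label (f x) refl
      where
      by-label : ∀ l → f x ≡ l → ExactlyOne (λ y → Adj G x y × f y ≡ suc h)
      by-label zero fx = condA x fx h
      by-label (suc i) fx with c4-position i h
      ... | inj₁ refl = exactlyOne-swap (condB i x fx)
      ... | inj₂ (inj₁ adj) = ⊥-elim (lonely fx adj)
      ... | inj₂ (inj₂ refl) = condD x i fx

  -- (A), (B), (D') are LonelyUniquelyDominated for unlabelled vertices,
  -- the own label, and the antipodal label; (C') adds NoMixedDomination.
  profile→amenable : DominationProfile → AmenableLabelling
  profile→amenable (unique , no-mixed) = condA , condB , condC , condD
    where
    own-label : ∀ {x i} → f x ≡ suc i → ExactlyOne (λ y → Adj G x y × f y ≡ suc i)
    own-label {x} {i} fx = unique x i (labelled-lonely fx (Graph.adj-irrefl C4))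

    condA : ∀ x → f x ≡ zero → ∀ i → ExactlyOne (λ y → Adj G x y × f y ≡ suc i)
    condA x fx i = unique x i (unlabelled-lonely fx)

    condB : ∀ i → IsMatching G (λ y → f y ≡ suc i)
    condB i x fx = exactlyOne-swap (own-label fx)

    -- The neighbour given by (B) is the only one labelled i or i+1,
    -- since a neighbour with the other label would be a mixed domination.
    condC : ∀ i → IsMatching G (λ y → (f y ≡ suc i) ⊎ (f y ≡ suc (next4 i)))
    condC i x (inj₁ fx) with own-label fx
    ... | y , (xy , fy) , only = y , (inj₁ fy , xy) , λ where
      z (inj₁ fz , xz) → only z (xz , fz)
      z (inj₂ fz , xz) → ⊥-elim (no-mixed fx (inj₁ refl) xz fz)
    condC i x (inj₂ fx) with own-label fx
    ... | y , (xy , fy) , only = y , (inj₂ fy , xy) , λ where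
      z (inj₂ fz , xz) → only z (xz , fz)
      z (inj₁ fz , xz) → ⊥-elim (no-mixed fx (inj₂ refl) xz fz)

    condD : ∀ x i → f x ≡ suc i → ExactlyOne (λ y → Adj G x y × f y ≡ suc (antipode i))
    condD x i fx = unique x (antipode i) (labelled-lonely fx (antipode-not-adjacent i))

module ParallelEOD {V : Set} (_≟_ : DecidableEquality V) (G : Graph V)
                   (D : V × Fin 4 → Set) (eod : IsEOD (G □ C4) D)
                   (parallel : IsParallel G C4 D) where

  dominator : V × Fin 4 → V × Fin 4
  dominator w = proj₁ (proj₁ eod w)

  dominator-∈ : ∀ w → D (dominator w)
  dominator-∈ w = proj₁ (proj₂ (proj₁ eod w))

  dominator-adj : ∀ w → Adj (G □ C4) (dominator w) w
  dominator-adj w = proj₂ (proj₂ (proj₁ eod w))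

  same : ∀ {u v w} → D u → D v → Adj (G □ C4) u w → Adj (G □ C4) v w → u ≡ v
  same = same-dominator (≡-dec _≟_ _≟ᶠ_) {X = G □ C4} eod

  -- Two members of D in one fibre would be adjacent (forbidden by
  -- parallelism) or antipodal (both dominating a common neighbour).
  fibre-unique : ∀ {g i j} → D (g , i) → D (g , j) → j ≡ i
  fibre-unique {g} {i} {j} Di Dj with c4-position i j
  ... | inj₁ j≡i = j≡i
  ... | inj₂ (inj₁ adj) = ⊥-elim (parallel (g , i) (g , j) Di Dj (inj₁ (refl , adj)) refl)
  ... | inj₂ (inj₂ refl) = ⊥-elim (antipode-not-self i (cong proj₂
          (same Dj Di (inj₁ (refl , inj₂ refl)) (inj₁ (refl , inj₁ refl)))))

  -- D meets the fibre of g iff the dominator of one of its four vertices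
  -- lies in it, which is decidable.
  occupied? : ∀ g → (Σ (Fin 4) λ i → D (g , i)) ⊎ (∀ i → ¬ D (g , i))
  occupied? g with any? (λ h → proj₁ (dominator (g , h)) ≟ g)
  ... | yes (h , in-fibre) = inj₁ (proj₂ (dominator (g , h)) ,
          subst (λ x → D (x , proj₂ (dominator (g , h)))) in-fibre (dominator-∈ (g , h)))
  ... | no none = inj₂ λ i Di → none (next4 i , cong proj₁
          (same (dominator-∈ (g , next4 i)) Di (dominator-adj (g , next4 i)) (inj₁ (refl , inj₁ refl))))

  label : V → Fin 5
  label g with occupied? g
  ... | inj₁ (i , _) = suc i
  ... | inj₂ _ = zero

  label-sound : ∀ {w} → Labelling.LabelSet G label w → D w
  label-sound {g , i} lg with occupied? g
  label-sound {g , i} refl | inj₁ (.i , Di) = Di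

  label-complete : ∀ {w} → D w → Labelling.LabelSet G label w
  label-complete {g , i} Di with occupied? g
  ... | inj₁ (j , Dj) = cong suc (fibre-unique Di Dj)
  ... | inj₂ empty = ⊥-elim (empty i Di)

parallel-EOD⇔amenable : ∀ {V} → DecidableEquality V → (G : Graph V) →
  (Σ (V × Fin 4 → Set) (λ D → IsEOD (G □ C4) D × IsParallel G C4 D))
    ⇔ C4ParallelAmenable G
parallel-EOD⇔amenable _≟_ G = mk⇔ forward backward
  where
  open Labelling G

  forward : Σ (_ → Set) (λ D → IsEOD (G □ C4) D × IsParallel G C4 D) → C4ParallelAmenable G
  forward (D , eod , parallel) =
    label , profile→amenable label (EOD→profile label _≟_ labelSet-EOD)
    where
    open ParallelEOD _≟_ G D eod parallel
    labelSet-EOD : IsEOD (G □ C4) (LabelSet label)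
    labelSet-EOD = IsEOD-cong {X = G □ C4} label-complete label-sound eod

  backward : C4ParallelAmenable G → Σ (_ → Set) (λ D → IsEOD (G □ C4) D × IsParallel G C4 D)
  backward (f , amenable) =
    LabelSet f , profile→EOD f (amenable→profile f amenable) , LabelSet-parallel f

mainTheorem9 : (n : ℕ) (G : FinGraph n) →
    (Σ (Fin n × Fin 4 → Set) (λ D → IsEOD (G □ C4) D × IsParallel G C4 D))
      ⇔ C4ParallelAmenable G
mainTheorem9 n G = parallel-EOD⇔amenable _≟ᶠ_ G
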